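{- Let $k\ge 2$ and let $\mathcal{F}=(V,\mathcal{E})$ be a $k$-uniform edge-minimal hypertree on $n=|V|$ vertices. Then $|\mathcal{E}|\le \frac{n(n-1)(n-k+1)}{2}$.
   Context: A $k$-uniform hypergraph $\mathcal{H}=(V,\mathcal{E})$ consists of a finite vertex set $V$ and a set $\mathcal{E}$ of $k$-element subsets of $V$ (no multiple edges). A $k$-uniform hypergraph is a chain if there is a sequence $v_1,\dots,v_l$ of its vertices in which every vertex appears at least once (possibly more times), $v_1\ne v_l$, and its edge set consists of exactly the $l-k+1$ distinct sets $\{v_i,\dots,v_{i+k-1}\}$, $1\le i\le l-k+1$; it is a semicycle if the same holds with $v_1=v_l$ instead. $\mathcal{H}$ is chain-connected if every pair of distinct vertices is contained in some subhypergraph of $\mathcal{H}$ that is a chain; semicycle-free if no subhypergraph is a semicycle. A hypertree is a chain-connected, semicycle-free $k$-uniform hypergraph. An edge-minimal hypertree is a hypertree $(V,\mathcal{E})$ such that for every $e\in\mathcal{E}$, $(V,\mathcal{E}\setminus\{e\})$ is not a hypertree. -}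

module Defs where

open import Data.Nat using (ℕ; zero; suc; _≤_; _≤ᵇ_)
open import Data.Bool using (if_then_else_)
open import Data.Fin using (Fin)
open import Data.Fin.Subset using (Subset; ⊥; ⁅_⁆; _∪_; ∣_∣)
open import Data.List using (List; []; _∷_; length; take; map; head; last)
open import Data.List.Relation.Unary.All using (All)
open import Data.List.Relation.Unary.Unique.Propositional using (Unique)
open import Data.List.Membership.Propositional using (_∈_)
open import Data.List.Relation.Binary.Subset.Propositional using (_⊆_)
open import Data.Maybe using (Maybe; just)
open import Data.Product using (Σ; _×_; ∃)
open import Relation.Binary.PropositionalEquality using (_≡_; _≢_)
open import Relation.Nullary using (¬_)

-- A k-uniform hypergraph on the vertex set V = Fin n:
-- edges are k-element subsets of Fin n, listed without repetition
-- (no multiple edges), so |E| = length of the list.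
record Hypergraph (n k : ℕ) : Set where
  constructor mkHG
  field
    edges    : List (Subset n)
    uniform  : All (λ e → ∣ e ∣ ≡ k) edges
    noMulti  : Unique edges
open Hypergraph public

toSet : ∀ {n} → List (Fin n) → Subset n
toSet []       = ⊥
toSet (x ∷ xs) = ⁅ x ⁆ ∪ toSet xs

windows : ∀ {A : Set} → ℕ → List A → List (List A)
windows k []       = []
windows k (x ∷ xs) =
  if k ≤ᵇ suc (length xs) then take k (x ∷ xs) ∷ windows k xs else []

-- The subhypergraph it spans has vertex set = vertices of s and edge set
-- = the windows; hence this is exactly a chain/semicycle subhypergraph.
record Walk {n : ℕ} (k : ℕ) (E : List (Subset n)) (s : List (Fin n)) : Set where
  field
    long       : k ≤ length s
    windowsK   : All Unique (windows k s)
    distinctW  : Unique (map toSet (windows k s))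
    windowsInE : All (λ w → toSet w ∈ E) (windows k s)

IsChainSeq : ∀ {n} (k : ℕ) (E : List (Subset n)) (s : List (Fin n)) → Set
IsChainSeq k E s = Walk k E s × (∀ a b → head s ≡ just a → last s ≡ just b → a ≢ b)

IsSemicycleSeq : ∀ {n} (k : ℕ) (E : List (Subset n)) (s : List (Fin n)) → Set
IsSemicycleSeq k E s = Walk k E s × (Σ (Fin _) λ a → head s ≡ just a × last s ≡ just a)

ChainConnected : ∀ {n k} → Hypergraph n k → Set
ChainConnected {n} {k} H =
  (u v : Fin n) → u ≢ v →
  Σ (List (Fin n)) λ s → IsChainSeq k (edges H) s × u ∈ s × v ∈ s

SemicycleFree : ∀ {n k} → Hypergraph n k → Set
SemicycleFree {n} {k} H = (s : List (Fin n)) → ¬ IsSemicycleSeq k (edges H) s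

IsHypertree : ∀ {n k} → Hypergraph n k → Set
IsHypertree H = ChainConnected H × SemicycleFree H

DeleteEdge : ∀ {n k} → Hypergraph n k → Hypergraph n k → Set
DeleteEdge H H' = Σ _ λ e → e ∈ edges H × (¬ e ∈ edges H')
  × (edges H' ⊆ edges H) × (∀ {f} → f ∈ edges H → f ≢ e → f ∈ edges H')

IsEdgeMinimalHypertree : ∀ {n k} → Hypergraph n k → Set
IsEdgeMinimalHypertree H =
  IsHypertree H × (∀ H' → DeleteEdge H H' → ¬ IsHypertree H')

module Submission where

-- For every unordered pair {u,v} of distinct vertices fix one chain of F
-- through u and v, and let S (chainEdges below) list all windows of these chains.
--  * Every edge of F occurs in S: deleting an edge outside S keeps every fixed
--    chain, hence chain-connectivity, and cannot create a semicycle, which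
--    contradicts edge-minimality.
--  * In a semicycle-free hypergraph a walk never repeats a vertex (the segment
--    between two occurrences would be a semicycle), so a chain has at most n
--    vertices and therefore at most n-k+1 windows.
-- As there are n(n-1)/2 pairs, |E| ≤ |S| ≤ n(n-1)/2 · (n-k+1).

open import Defs
open import Data.Nat using (ℕ; _≤_; _*_; _∸_; _+_)
open import Data.List using (length)

open import Data.Nat using (zero; suc; _<_; _≤ᵇ_; z≤n; s≤s; _≤?_)
open import Data.Nat.Properties hiding (_≟_)
open import Data.Nat.Tactic.RingSolver using (solve-∀)
open import Data.Bool using (true; false; T)
import Data.Bool.Properties as Bool
open import Data.Fin using (Fin; zero; suc; _≟_)
open import Data.Fin.Subset using (Subset)
open import Data.Vec.Properties using (≡-dec)
open import Data.List
  using (List; []; _∷_; _++_; [_]; take; map; concatMap; allFin; filter; last)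
open import Data.List.Properties using (length-++; length-map; length-tabulate; ++-assoc; take-all)
open import Data.List.Relation.Unary.All as All using (All)
open import Data.List.Relation.Unary.All.Properties using (¬Any⇒All¬)
open import Data.List.Relation.Unary.Any using (here; there)
open import Data.List.Relation.Unary.AllPairs using ([]; _∷_)
open import Data.List.Relation.Unary.Unique.Propositional using (Unique)
import Data.List.Relation.Unary.Unique.Propositional.Properties as Unique
open import Data.List.Membership.Propositional using (_∈_; _∉_; lose)
open import Data.List.Membership.Propositional.Properties
  using (∈-map⁺; ∈-++⁺ˡ; ∈-++⁺ʳ; ∈-++⁻; ∈-∃++; ∈-filter⁺; ∈-filter⁻; ∈-allFin; ∈-concatMap⁺)
import Data.List.Membership.DecPropositional as DecMembership
open import Data.List.Relation.Binary.Sublist.Propositional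
  using ([]; _∷_; _∷ʳ_; minimum; ⊆-refl) renaming (_⊆_ to _⊑_)
open import Data.List.Relation.Binary.Sublist.Propositional.Properties
  using (All-resp-⊆; map⁺)
open import Data.Maybe using (just)
open import Data.Product using (_×_; _,_; proj₁; proj₂)
open import Data.Sum using (_⊎_; inj₁; inj₂)
open import Data.Empty using (⊥; ⊥-elim)
open import Relation.Binary.PropositionalEquality
  using (_≡_; _≢_; refl; sym; trans; cong; cong₂; subst; module ≡-Reasoning)
open import Relation.Nullary using (¬_; Dec; yes; no; ¬?)

private variable
  A B : Set

Unique-resp-⊑ : {xs ys : List A} → xs ⊑ ys → Unique ys → Unique xs
Unique-resp-⊑ []         []         = []
Unique-resp-⊑ (y ∷ʳ τ)   (_ ∷ u)    = Unique-resp-⊑ τ u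
Unique-resp-⊑ (refl ∷ τ) (px ∷ u)   = All-resp-⊆ τ px ∷ Unique-resp-⊑ τ u

Unique-length-≤ : {xs ys : List A} → Unique xs → (∀ {x} → x ∈ xs → x ∈ ys) →
                  length xs ≤ length ys
Unique-length-≤ {xs = []}     _        _   = z≤n
Unique-length-≤ {xs = x ∷ xs} {ys} (x∉xs ∷ u) xs⊆ys with ∈-∃++ (xs⊆ys (here refl))
... | a , b , refl = begin
    suc (length xs)           ≤⟨ s≤s (Unique-length-≤ u xs⊆ab) ⟩
    suc (length (a ++ b))     ≡⟨ cong suc (length-++ a) ⟩
    suc (length a + length b) ≡⟨ sym (+-suc (length a) (length b)) ⟩
    length a + suc (length b) ≡⟨ sym (length-++ a) ⟩
    length (a ++ x ∷ b)       ∎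
  where
  open ≤-Reasoning
  xs⊆ab : ∀ {y} → y ∈ xs → y ∈ a ++ b
  xs⊆ab y∈xs with ∈-++⁻ a (xs⊆ys (there y∈xs))
  ... | inj₁ y∈a         = ∈-++⁺ˡ y∈a
  ... | inj₂ (here y≡x)  = ⊥-elim (All.lookup x∉xs y∈xs (sym y≡x))
  ... | inj₂ (there y∈b) = ∈-++⁺ʳ a y∈b

length-concatMap-≤ : (f : A → List B) {c : ℕ} → (∀ x → length (f x) ≤ c) →
                     ∀ xs → length (concatMap f xs) ≤ length xs * c
length-concatMap-≤ f bound []       = z≤n
length-concatMap-≤ f bound (x ∷ xs) rewrite length-++ (f x) {concatMap f xs} =
  +-mono-≤ (bound x) (length-concatMap-≤ f bound xs)

prefix-⊑-take : ∀ j (t r : List A) → length t ≤ j → t ⊑ take j (t ++ r)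
prefix-⊑-take j       []      r _       = minimum _
prefix-⊑-take (suc j) (x ∷ t) r (s≤s p) = refl ∷ prefix-⊑-take j t r p

length-++-≥ : (t q : List A) → length t ≤ length (t ++ q)
length-++-≥ t q rewrite length-++ t {q} = m≤m+n _ _

take-++ˡ : ∀ j (t r : List A) → j ≤ length t → take j (t ++ r) ≡ take j t
take-++ˡ zero    t       r _       = refl
take-++ˡ (suc j) (x ∷ t) r (s≤s p) = cong (x ∷_) (take-++ˡ j t r p)

length-allFin : ∀ n → length (allFin n) ≡ n
length-allFin n = length-tabulate (λ i → i)

windows-cons : ∀ k (x : A) xs → k ≤ suc (length xs) →
               windows k (x ∷ xs) ≡ take k (x ∷ xs) ∷ windows k xs
windows-cons k x xs p with k ≤ᵇ suc (length xs) | ≤⇒≤ᵇ p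
... | true | _ = refl

windows-short : ∀ k (xs : List A) → length xs < k → windows k xs ≡ []
windows-short k []       p = refl
windows-short k (x ∷ xs) p with k ≤ᵇ suc (length xs) in eq
... | false = refl
... | true  = ⊥-elim (<⇒≱ p (≤ᵇ⇒≤ k (suc (length xs)) (subst T (sym eq) _)))

windows-tail : ∀ k (x : A) xs → windows k xs ⊑ windows k (x ∷ xs)
windows-tail k x xs with k ≤? suc (length xs)
... | yes p rewrite windows-cons k x xs p = _ ∷ʳ ⊆-refl
... | no ¬p rewrite windows-short k xs (≤-trans (n≤1+n _) (≰⇒> ¬p)) = minimum _

windows-prefix : ∀ k (t q : List A) → windows k t ⊑ windows k (t ++ q)
windows-prefix k []      q = minimum _
windows-prefix k (x ∷ t) q with k ≤? suc (length t)
... | no ¬p rewrite windows-short k (x ∷ t) (≰⇒> ¬p) = minimum _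
... | yes p rewrite windows-cons k x t p
                  | windows-cons k x (t ++ q) (≤-trans p (s≤s (length-++-≥ t q)))
                  | take-++ˡ k (x ∷ t) q p = refl ∷ windows-prefix k t q

length-windows : ∀ j (s : List A) → length (windows (suc j) s) ≤ length s ∸ j
length-windows j []       = z≤n
length-windows j (x ∷ xs) with suc j ≤? suc (length xs)
... | yes (s≤s p) rewrite windows-cons (suc j) x xs (s≤s p) | +-∸-assoc 1 p =
  s≤s (length-windows j xs)
... | no ¬p rewrite windows-short (suc j) (x ∷ xs) (≰⇒> ¬p) = z≤n

∸-suc-≤ : ∀ m j → m ∸ j ≤ m ∸ suc j + 1
∸-suc-≤ zero    zero    = z≤n
∸-suc-≤ zero    (suc j) = z≤n
∸-suc-≤ (suc m) zero    = ≤-reflexive (+-comm 1 m)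
∸-suc-≤ (suc m) (suc j) = ∸-suc-≤ m j

length-windows-≤ : ∀ {k m} → 1 ≤ k → (s : List A) → length s ≤ m →
                   length (windows k s) ≤ m ∸ k + 1
length-windows-≤ {k = suc j} {m} _ s s≤m =
  ≤-trans (length-windows j s) (≤-trans (∸-monoˡ-≤ j s≤m) (∸-suc-≤ m j))

module _ {n k : ℕ} where

  walk-retarget : ∀ {E E' : List (Subset n)} {s} →
                  All (λ w → toSet w ∈ E') (windows k s) → Walk k E s → Walk k E' s
  walk-retarget inE' w = record
    { long = Walk.long w ; windowsK = Walk.windowsK w
    ; distinctW = Walk.distinctW w ; windowsInE = inE' }

  walk-⊑ : ∀ {E : List (Subset n)} {s t} → k ≤ length t →
           windows k t ⊑ windows k s → Walk k E s → Walk k E t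
  walk-⊑ long τ w = record
    { long = long
    ; windowsK = All-resp-⊆ τ (Walk.windowsK w)
    ; distinctW = Unique-resp-⊑ (map⁺ toSet τ) (Walk.distinctW w)
    ; windowsInE = All-resp-⊆ τ (Walk.windowsInE w) }

  first-window-unique : ∀ {E : List (Subset n)} x xs → Walk k E (x ∷ xs) →
                        Unique (take k (x ∷ xs))
  first-window-unique x xs w =
    All.head (subst (All Unique) (windows-cons k x xs (Walk.long w)) (Walk.windowsK w))

  last-snoc : ∀ (x y : Fin n) m → last (x ∷ m ++ [ y ]) ≡ just y
  last-snoc x y []      = refl
  last-snoc x y (z ∷ m) = last-snoc z y m

  module _ {E : List (Subset n)} (semicycleFree : ∀ s → ¬ IsSemicycleSeq k E s) where

    -- The first vertex of a walk never reappears: if the segment x … x has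
    -- at least k vertices it is a semicycle, otherwise it lies inside the
    -- first window, whose vertices are distinct.
    head-not-repeated : ∀ x m q → ¬ Walk k E (x ∷ m ++ x ∷ q)
    head-not-repeated x m q w = loop-short-or-long (k ≤? length loop)
      where
      loop : List (Fin n)
      loop = x ∷ m ++ [ x ]
      w' : Walk k E (loop ++ q)
      w' = subst (Walk k E) (cong (x ∷_) (sym (++-assoc m [ x ] q))) w
      loop-not-unique : ¬ Unique loop
      loop-not-unique (x∉ ∷ _) = All.lookup x∉ (∈-++⁺ʳ m (here refl)) refl
      loop-short-or-long : Dec (k ≤ length loop) → ⊥
      loop-short-or-long (yes k≤l) =
        semicycleFree loop (walk-⊑ k≤l (windows-prefix k loop q) w' , x , refl , last-snoc x x m)
      loop-short-or-long (no k≰l) = loop-not-unique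
        (Unique-resp-⊑ (prefix-⊑-take k loop q (<⇒≤ (≰⇒> k≰l))) (first-window-unique x _ w'))

    walk-unique : ∀ s → Walk k E s → Unique s
    walk-unique []       w = []
    walk-unique (x ∷ xs) w with k ≤? length xs
    ... | yes k≤xs = ¬Any⇒All¬ xs x∉xs ∷ walk-unique xs (walk-⊑ k≤xs (windows-tail k x xs) w)
      where
      x∉xs : x ∉ xs
      x∉xs x∈xs with ∈-∃++ x∈xs
      ... | m , q , refl = head-not-repeated x m q w
    ... | no k≰xs = subst Unique (take-all k (x ∷ xs) (≰⇒> k≰xs)) (first-window-unique x xs w)

    walk-length : ∀ s → Walk k E s → length s ≤ n
    walk-length s w = subst (length s ≤_) (length-allFin n)
      (Unique-length-≤ (walk-unique s w) (λ {x} _ → ∈-allFin x))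

-- Unordered pairs of distinct vertices, each listed once as (u , v) with u < v.
distinctPairs : (n : ℕ) → List (Fin n × Fin n)
distinctPairs zero    = []
distinctPairs (suc n) =
  map (λ v → zero , suc v) (allFin n) ++ map (λ p → suc (proj₁ p) , suc (proj₂ p)) (distinctPairs n)

-- 2(1 + 2 + … + n) = (n+1)n, in the recursive form used below
triangular-step : ∀ n → 2 * n + n * (n ∸ 1) ≡ suc n * n
triangular-step zero    = refl
triangular-step (suc m) = ring m
  where
  ring : ∀ m → 2 * suc m + suc m * m ≡ suc (suc m) * suc m
  ring = solve-∀

length-distinctPairs : ∀ n → 2 * length (distinctPairs n) ≡ n * (n ∸ 1)
length-distinctPairs zero    = refl
length-distinctPairs (suc n) = begin
    2 * length (distinctPairs (suc n))   ≡⟨ cong (2 *_) length-suc ⟩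
    2 * (n + length (distinctPairs n))   ≡⟨ *-distribˡ-+ 2 n _ ⟩
    2 * n + 2 * length (distinctPairs n) ≡⟨ cong (2 * n +_) (length-distinctPairs n) ⟩
    2 * n + n * (n ∸ 1)                  ≡⟨ triangular-step n ⟩
    suc n * n                            ∎
  where
  open ≡-Reasoning
  length-suc : length (distinctPairs (suc n)) ≡ n + length (distinctPairs n)
  length-suc = trans (length-++ (map (λ v → zero , suc v) (allFin n)))
    (cong₂ _+_ (trans (length-map _ (allFin n)) (length-allFin n))
               (length-map _ (distinctPairs n)))

distinctPairs-cover : ∀ {n} (u v : Fin n) → u ≢ v →
                      (u , v) ∈ distinctPairs n ⊎ (v , u) ∈ distinctPairs n
distinctPairs-cover zero zero u≢v = ⊥-elim (u≢v refl)
distinctPairs-cover {suc n} zero (suc v) _ = inj₁ (∈-++⁺ˡ (∈-map⁺ _ (∈-allFin v)))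
distinctPairs-cover {suc n} (suc u) zero _ = inj₂ (∈-++⁺ˡ (∈-map⁺ _ (∈-allFin u)))
distinctPairs-cover {suc n} (suc u) (suc v) u≢v
  with distinctPairs-cover u v (λ u≡v → u≢v (cong suc u≡v))
... | inj₁ p = inj₁ (∈-++⁺ʳ _ (∈-map⁺ (λ p → suc (proj₁ p) , suc (proj₂ p)) p))
... | inj₂ p = inj₂ (∈-++⁺ʳ _ (∈-map⁺ (λ p → suc (proj₁ p) , suc (proj₂ p)) p))

semicycleFree-mono : ∀ {n k} {H H' : Hypergraph n k} →
                     (∀ {e} → e ∈ edges H' → e ∈ edges H) → SemicycleFree H → SemicycleFree H'
semicycleFree-mono H'⊆H free s (w , closed) =
  free s (walk-retarget (All.map H'⊆H (Walk.windowsInE w)) w , closed)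

_≟ˢ_ : ∀ {n} (a b : Subset n) → Dec (a ≡ b)
_≟ˢ_ = ≡-dec Bool._≟_

otherThan? : ∀ {n} (e f : Subset n) → Dec (f ≢ e)
otherThan? e f = ¬? (f ≟ˢ e)

deleteEdge : ∀ {n k} → Hypergraph n k → Subset n → Hypergraph n k
deleteEdge H e = mkHG (filter (otherThan? e) (edges H))
  (All.tabulate (λ f∈ → All.lookup (uniform H) (proj₁ (∈-filter⁻ (otherThan? e) f∈))))
  (Unique.filter⁺ (otherThan? e) (noMulti H))

module _ {n k : ℕ} (H : Hypergraph n k) (e : Subset n) where

  deleteEdge-⊆ : ∀ {f} → f ∈ edges (deleteEdge H e) → f ∈ edges H
  deleteEdge-⊆ f∈ = proj₁ (∈-filter⁻ (otherThan? e) f∈)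

  deleteEdge-keeps : ∀ {f} → f ∈ edges H → f ≢ e → f ∈ edges (deleteEdge H e)
  deleteEdge-keeps = ∈-filter⁺ (otherThan? e)

  deleteEdge-isDeletion : e ∈ edges H → DeleteEdge H (deleteEdge H e)
  deleteEdge-isDeletion e∈H =
    e , e∈H , (λ e∈ → proj₂ (∈-filter⁻ (otherThan? e) {xs = edges H} e∈) refl) , deleteEdge-⊆ , deleteEdge-keeps

module FixedChains {n k : ℕ} (F : Hypergraph n k) (connected : ChainConnected F) where

  chainOf : Fin n → Fin n → List (Fin n)
  chainOf u v with u ≟ v
  ... | yes _   = []
  ... | no  u≢v = proj₁ (connected u v u≢v)

  chainOf-spec : ∀ u v → u ≢ v →
                 IsChainSeq k (edges F) (chainOf u v) × u ∈ chainOf u v × v ∈ chainOf u v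
  chainOf-spec u v u≢v with u ≟ v
  ... | yes u≡v = ⊥-elim (u≢v u≡v)
  ... | no  u≢v = proj₂ (connected u v u≢v)

  chainWindows : Fin n × Fin n → List (Subset n)
  chainWindows (u , v) = map toSet (windows k (chainOf u v))

  chainEdges : List (Subset n)
  chainEdges = concatMap chainWindows (distinctPairs n)

  chainWindow-used : ∀ {u v win} → (u , v) ∈ distinctPairs n →
                     win ∈ windows k (chainOf u v) → toSet win ∈ chainEdges
  chainWindow-used {win = win} uv∈ win∈ =
    ∈-concatMap⁺ chainWindows (lose {P = λ p → toSet win ∈ chainWindows p} uv∈ (∈-map⁺ toSet win∈))

  chain-survives : ∀ {e u v} → e ∉ chainEdges → (u , v) ∈ distinctPairs n → u ≢ v →
                   IsChainSeq k (edges (deleteEdge F e)) (chainOf u v) × u ∈ chainOf u v × v ∈ chainOf u v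
  chain-survives {e} {u} {v} e∉ uv∈ u≢v with chainOf-spec u v u≢v
  ... | (w , ends) , u∈ , v∈ = (walk-retarget windows-kept w , ends) , u∈ , v∈
    where
    windows-kept : All (λ win → toSet win ∈ edges (deleteEdge F e)) (windows k (chainOf u v))
    windows-kept = All.tabulate λ win∈ →
      deleteEdge-keeps F e (All.lookup (Walk.windowsInE w) win∈)
        (λ win≡e → e∉ (subst (_∈ chainEdges) win≡e (chainWindow-used uv∈ win∈)))

  deleteEdge-connected : ∀ {e} → e ∉ chainEdges → ChainConnected (deleteEdge F e)
  deleteEdge-connected e∉ u v u≢v with distinctPairs-cover u v u≢v
  ... | inj₁ uv∈ = chainOf u v , chain-survives e∉ uv∈ u≢v
  ... | inj₂ vu∈ with chain-survives e∉ vu∈ (λ v≡u → u≢v (sym v≡u))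
  ...   | chain , v∈ , u∈ = chainOf v u , chain , u∈ , v∈

  -- In an edge-minimal hypertree every edge is used by some fixed chain,
  -- since otherwise deleting it would leave a hypertree.
  edges-⊆-chainEdges : SemicycleFree F → (∀ H' → DeleteEdge F H' → ¬ IsHypertree H') →
                       ∀ {e} → e ∈ edges F → e ∈ chainEdges
  edges-⊆-chainEdges free minimal {e} e∈F with DecMembership._∈?_ _≟ˢ_ e chainEdges
  ... | yes e∈ = e∈
  ... | no  e∉ = ⊥-elim (minimal (deleteEdge F e) (deleteEdge-isDeletion F e e∈F)
                                 (connected' , free'))
    where
    connected' : ChainConnected (deleteEdge F e)
    connected' = deleteEdge-connected e∉
    free' : SemicycleFree (deleteEdge F e)
    free' = semicycleFree-mono {H = F} {H' = deleteEdge F e} (deleteEdge-⊆ F e) free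

  -- Each fixed chain has at most n ∸ k + 1 windows, as it repeats no vertex.
  length-chainWindows : 1 ≤ k → SemicycleFree F → ∀ p → length (chainWindows p) ≤ n ∸ k + 1
  length-chainWindows 1≤k free (u , v) rewrite length-map toSet (windows k (chainOf u v)) =
    length-windows-≤ 1≤k (chainOf u v) (chain-length u v)
    where
    chain-length : ∀ u v → length (chainOf u v) ≤ n
    chain-length u v with u ≟ v
    ... | yes _   = z≤n
    ... | no  u≢v = walk-length free _ (proj₁ (proj₁ (proj₂ (connected u v u≢v))))

theorem9 : (n k : ℕ) → 2 ≤ k → (F : Hypergraph n k) → IsEdgeMinimalHypertree F →
    2 * length (edges F) ≤ n * (n ∸ 1) * (n ∸ k + 1)
theorem9 n k 2≤k F ((connected , free) , minimal) = begin
  2 * length (edges F)                         ≤⟨ *-monoʳ-≤ 2 edges-bound ⟩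
  2 * (length (distinctPairs n) * (n ∸ k + 1)) ≡⟨ *-assoc 2 (length (distinctPairs n)) (n ∸ k + 1) ⟨
  2 * length (distinctPairs n) * (n ∸ k + 1)   ≡⟨ cong (_* (n ∸ k + 1)) (length-distinctPairs n) ⟩
  n * (n ∸ 1) * (n ∸ k + 1)                    ∎
  where
  open ≤-Reasoning
  open FixedChains F connected
  edges-bound : length (edges F) ≤ length (distinctPairs n) * (n ∸ k + 1)
  edges-bound = ≤-trans (Unique-length-≤ (noMulti F) (edges-⊆-chainEdges free minimal))
    (length-concatMap-≤ chainWindows (length-chainWindows (≤-trans (s≤s z≤n) 2≤k) free) (distinctPairs n))
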